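{- Let $T_1$ and $T_2$ be trees of orders $m\geq 2$ and $n\geq 2$, respectively. Then $\operatorname{dem}(T_1\Box T_2)=\max\{m,n\}$.
   Context: For a graph $X$, a set $M\subseteq V(X)$ and an edge $e\in E(X)$, $P_X(M,e)$ is the set of pairs $(x,y)$ with $x\in M$, $y\in V(X)$ such that $d_X(x,y)\neq d_{X-e}(x,y)$. An edge $e$ is monitored by $x$ if $P_X(\{x\},e)\ne\emptyset$. A distance-edge-monitoring set is a set $M$ such that every edge is monitored by some vertex of $M$; $\operatorname{dem}(X)$ is the minimum size of such a set. $\Box$ denotes the Cartesian product of graphs. -}

module Defs where

open import Level using (0ℓ)
open import Data.Nat using (ℕ; zero; suc; _≤_; _+_)
open import Data.Fin using (Fin)
open import Data.Product using (Σ; ∃; ∃-syntax; _×_; _,_)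
open import Data.Sum using (_⊎_)
open import Data.List using (List; []; _∷_; length)
open import Data.List.Membership.Propositional using (_∈_)
open import Data.List.Relation.Unary.Unique.Propositional using (Unique)
open import Data.Maybe using (Maybe; just; nothing)
open import Relation.Nullary using (¬_)
open import Relation.Binary.PropositionalEquality using (_≡_; _≢_)

record Graph (V : Set) : Set₁ where
  field
    Adj    : V → V → Set
    sym    : ∀ {x y} → Adj x y → Adj y x
    irrefl : ∀ {x} → ¬ Adj x x
open Graph public

data Walk {V : Set} (G : Graph V) : V → V → ℕ → Set where
  here : ∀ {x} → Walk G x x zero
  step : ∀ {x y z k} → Adj G x y → Walk G y z k → Walk G x z (suc k)

-- Dist G x y d : the distance from x to y in G is d
-- (just k = shortest walk has length k; nothing = y unreachable, i.e. ∞).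
Dist : {V : Set} → Graph V → V → V → Maybe ℕ → Set
Dist G x y (just k) = Walk G x y k × (∀ l → Walk G x y l → k ≤ l)
Dist G x y nothing  = ∀ l → ¬ Walk G x y l

Connected : {V : Set} → Graph V → Set
Connected G = ∀ x y → ∃[ k ] Walk G x y k

data Path {V : Set} (G : Graph V) : List V → Set where
  single : ∀ {x} → Path G (x ∷ [])
  cons   : ∀ {x y vs} → Adj G x y → Path G (y ∷ vs) → Path G (x ∷ y ∷ vs)

data Last {V : Set} : List V → V → Set where
  last-one  : ∀ {x} → Last (x ∷ []) x
  last-cons : ∀ {x y vs} → Last vs y → Last (x ∷ vs) y

HasCycle : {V : Set} → Graph V → Set
HasCycle {V} G = ∃[ v₀ ] ∃[ v₁ ] ∃[ v₂ ] ∃[ vs ] ∃[ vk ]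
  (Unique (v₀ ∷ v₁ ∷ v₂ ∷ vs) × Path G (v₀ ∷ v₁ ∷ v₂ ∷ vs)
   × Last (v₀ ∷ v₁ ∷ v₂ ∷ vs) vk × Adj G vk v₀)

IsTree : {m : ℕ} → Graph (Fin m) → Set
IsTree G = Connected G × ¬ HasCycle G

SameEdge : {V : Set} → V → V → V → V → Set
SameEdge a b u v = (a ≡ u × b ≡ v) ⊎ (a ≡ v × b ≡ u)

removeEdge : {V : Set} → Graph V → V → V → Graph V
removeEdge G u v = record
  { Adj    = λ a b → Adj G a b × ¬ SameEdge a b u v
  ; sym    = λ { (p , q) → sym G p , λ { (_⊎_.inj₁ (a , b)) → q (_⊎_.inj₂ (b , a))
                                        ; (_⊎_.inj₂ (a , b)) → q (_⊎_.inj₁ (b , a)) } }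
  ; irrefl = λ { (p , _) → irrefl G p }
  }

_□_ : {V W : Set} → Graph V → Graph W → Graph (V × W)
_□_ {V} {W} G H = record
  { Adj    = λ { (a , b) (c , d) → (Adj G a c × b ≡ d) ⊎ (a ≡ c × Adj H b d) }
  ; sym    = λ { (_⊎_.inj₁ (p , Eq.refl)) → _⊎_.inj₁ (sym G p , Eq.refl)
               ; (_⊎_.inj₂ (Eq.refl , q)) → _⊎_.inj₂ (Eq.refl , sym H q) }
  ; irrefl = λ { (_⊎_.inj₁ (p , _)) → irrefl G p
               ; (_⊎_.inj₂ (_ , q)) → irrefl H q }
  }
  where import Relation.Binary.PropositionalEquality as Eq

Monitors : {V : Set} → Graph V → V → V → V → Set
Monitors G x u v = ∃[ y ] ∃[ d₁ ] ∃[ d₂ ]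
  (Dist G x y d₁ × Dist (removeEdge G u v) x y d₂ × d₁ ≢ d₂)

IsDEMSet : {V : Set} → Graph V → List V → Set
IsDEMSet G M = ∀ u v → Adj G u v → ∃[ x ] (x ∈ M × Monitors G x u v)

DEM : {V : Set} → Graph V → ℕ → Set
DEM G k = (∃[ M ] (Unique M × IsDEMSet G M × length M ≡ k))
        × (∀ M → Unique M → IsDEMSet G M → k ≤ length M)

{-# OPTIONS --safe #-}
module Submission where

-- Call T₁ × {b} the row b and {a} × T₂ the column a of T₁ □ T₂.  A vertex outside row b monitors no
-- edge e of row b: a walk from it can be rerouted, first along its own row and then along the column
-- of its target, without using e and without getting longer.  So a distance-edge-monitoring set meets
-- every row and every column, and has at least max{m, n} elements.  Conversely every vertex (a, b)
-- monitors every edge uv of its row: uv is a bridge of T₁, so some c is cut off from a in T₁ − uv,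
-- and a walk from (a, b) to (c, b) avoiding the edge must leave row b, which makes it strictly longer
-- than d(a, c).  Hence the max{m, n} vertices (min(i, m − 1), min(i, n − 1)), which meet every row
-- and every column, form a distance-edge-monitoring set.

open import Defs
open import Data.Nat using (ℕ; zero; suc; _≤_; _<_; _+_; _≥_; _⊔_; _⊓_; s≤s; z<s)
open import Data.Nat.Properties
  using ( ≤-antisym; ≤-trans; ≤-pred; ≮⇒≥; <⇒≢; <-irrefl; ≤-<-trans; +-suc; m<m+n
        ; m⊓n≤n; m≤n⇒m⊓n≡m; ⊓-distribˡ-⊔; m≤m⊔n; m≤n⊔m; ⊔-lub; module ≤-Reasoning )
open import Data.Nat.Induction using (<-rec)
open import Data.Fin using (Fin; zero; suc; toℕ; fromℕ<) renaming (_≟_ to _≟ᶠ_; _<_ to _<ᶠ_)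
open import Data.Fin.Properties using (any?; pigeonhole; toℕ<n; toℕ-fromℕ<; toℕ-injective)
open import Data.Product using (∃; ∃₂; ∃-syntax; _×_; _,_; proj₁; proj₂; swap)
import Data.Product as Product
open import Data.Product.Properties using (≡-dec)
open import Data.Sum using (_⊎_; inj₁; inj₂)
import Data.Sum as Sum
open import Data.Empty using (⊥-elim)
open import Data.Maybe using (Maybe; just; nothing)
open import Data.Maybe.Properties using (just-injective)
open import Data.List using (List; []; _∷_; length; map; allFin; lookup)
open import Data.List.Properties using (length-map; length-tabulate)
open import Data.List.Membership.Propositional using (_∈_)
open import Data.List.Membership.Propositional.Properties using (∈-map⁺; ∈-allFin)
open import Data.List.Relation.Unary.Any using (here; there; index)
open import Data.List.Relation.Unary.Any.Properties using (lookup-index)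
open import Data.List.Relation.Unary.All using ([])
open import Data.List.Relation.Unary.All.Properties using (¬Any⇒All¬)
open import Data.List.Relation.Unary.AllPairs using (_∷_; [])
open import Data.List.Relation.Unary.Unique.Propositional using (Unique)
open import Data.List.Relation.Unary.Unique.Propositional.Properties using (map⁺; allFin⁺)
open import Function using (id)
open import Relation.Nullary using (¬_; Dec; yes; no)
open import Relation.Nullary.Decidable using (map′; ¬?; _×-dec_; _⊎-dec_)
open import Relation.Binary.Definitions using (Decidable; DecidableEquality)
open import Relation.Binary.PropositionalEquality using (_≡_; _≢_; refl; cong; cong₂; subst)
import Relation.Binary.PropositionalEquality as ≡

private variable
  V W : Set
  x y z u v : V
  k l : ℕ
  G : Graph V
  H : Graph W

Homomorphism : Graph V → Graph W → (V → W) → Set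
Homomorphism G H f = ∀ {x y} → Adj G x y → Adj H (f x) (f y)

Reachable : Graph V → V → V → Set
Reachable G x y = ∃[ k ] Walk G x y k

Searchable : Set → Set₁
Searchable V = {P : V → Set} → (∀ x → Dec (P x)) → Dec (∃ P)

SameEdge? : DecidableEquality V → (a b u v : V) → Dec (SameEdge a b u v)
SameEdge? _≟_ a b u v = (a ≟ u ×-dec b ≟ v) ⊎-dec (a ≟ v ×-dec b ≟ u)

Walk-map : (f : V → W) → Homomorphism G H f → Walk G x y k → Walk H (f x) (f y) k
Walk-map f hom here       = here
Walk-map f hom (step p w) = step (hom p) (Walk-map f hom w)

_++ᵂ_ : Walk G x y k → Walk G y z l → Walk G x z (k + l)
here     ++ᵂ w′ = w′
step p w ++ᵂ w′ = step p (w ++ᵂ w′)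

Reachable-trans : Reachable G x y → Reachable G y z → Reachable G x z
Reachable-trans (_ , w) (_ , w′) = _ , w ++ᵂ w′

Reachable-sym : Reachable G x y → Reachable G y x
Reachable-sym         (_ , here)     = _ , here
Reachable-sym {G = G} (_ , step p w) = Reachable-trans (Reachable-sym (_ , w)) (_ , step (sym G p) here)

Walk-forget : Walk (removeEdge G u v) x y k → Walk G x y k
Walk-forget = Walk-map id proj₁

Path-forget : {xs : List V} → Path (removeEdge G u v) xs → Path G xs
Path-forget single     = single
Path-forget (cons p P) = cons (proj₁ p) (Path-forget P)

removeEdge-adjacent? : {G : Graph V} {u v : V} → DecidableEquality V →
                       Decidable (Adj G) → Decidable (Adj (removeEdge G u v))
removeEdge-adjacent? {u = u} {v} _≟_ adj? x y = adj? x y ×-dec ¬? (SameEdge? _≟_ x y u v)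

removeEdge-hom : (f : V → W) → (∀ {x y} → f x ≡ f y → x ≡ y) → Homomorphism G H f →
                 Homomorphism (removeEdge G u v) (removeEdge H (f u) (f v)) f
removeEdge-hom f f-inj hom (p , p≠uv) =
  hom p , λ e → p≠uv (Sum.map (Product.map f-inj f-inj) (Product.map f-inj f-inj) e)

Dist-unique : {d₁ d₂ : Maybe ℕ} → Dist G x y d₁ → Dist G x y d₂ → d₁ ≡ d₂
Dist-unique {d₁ = just k}  {just l}  (w , k-min) (w′ , l-min) = cong just (≤-antisym (k-min _ w′) (l-min _ w))
Dist-unique {d₁ = just k}  {nothing} (w , _) none             = ⊥-elim (none _ w)
Dist-unique {d₁ = nothing} {just l}  none (w′ , _)            = ⊥-elim (none _ w′)
Dist-unique {d₁ = nothing} {nothing} _ _                      = refl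

Dist-transfer : {x′ y′ : W} {d : Maybe ℕ} →
                (∀ {k} → Walk G x y k → Walk H x′ y′ k) → (∀ {k} → Walk H x′ y′ k → Walk G x y k) →
                Dist G x y d → Dist H x′ y′ d
Dist-transfer {d = just k}  to from (w , k-min) = to w , λ l w′ → k-min l (from w′)
Dist-transfer {d = nothing} to from none        = λ l w′ → none l (from w′)

-- Dist asks for a shortest walk, which can only be found constructively by deciding, for each
-- length, whether a walk of that length exists.
module Distance (_≟_ : DecidableEquality V) (search : Searchable V) {G : Graph V} (adj? : Decidable (Adj G)) where

  walk? : ∀ k x y → Dec (Walk G x y k)
  walk? zero    x y = map′ (λ { refl → here }) (λ { here → refl }) (x ≟ y)
  walk? (suc k) x y = map′ (λ (_ , p , w) → step p w) (λ { (step p w) → _ , p , w })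
                           (search λ z → adj? x z ×-dec walk? k z y)

  distance : Walk G x y k → ∃[ d ] Dist G x y (just d)
  distance {x = x} {y} {k} = <-rec (λ k → Walk G x y k → ∃[ d ] Dist G x y (just d)) shorten k
    where
    shorten : ∀ k → (∀ {l} → l < k → Walk G x y l → ∃[ d ] Dist G x y (just d)) →
              Walk G x y k → ∃[ d ] Dist G x y (just d)
    shorten k shorter w with any? (λ (i : Fin k) → walk? (toℕ i) x y)
    ... | yes (i , w′) = shorter (toℕ<n i) w′
    ... | no none      = k , w , λ l w′ → ≮⇒≥ λ l<k →
                           none (fromℕ< l<k , subst (Walk G x y) (≡.sym (toℕ-fromℕ< l<k)) w′)

SimplePath : Graph V → V → V → Set
SimplePath G x y = ∃[ vs ] (Unique (x ∷ vs) × Path G (x ∷ vs) × Last (x ∷ vs) y)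

module SimplePaths {V : Set} (_≟_ : DecidableEquality V) where
  open import Data.List.Membership.DecPropositional _≟_ using (_∈?_)

  SimplePath-suffix : {G : Graph V} {x y : V} {ys : List V} →
                      x ∈ ys → Unique ys → Path G ys → Last ys y → SimplePath G x y
  SimplePath-suffix {ys = _ ∷ vs} (here refl) u P L                 = vs , u , P , L
  SimplePath-suffix (there x∈) (_ ∷ u) (cons _ P) (last-cons L) = SimplePath-suffix x∈ u P L

  Walk⇒SimplePath : ∀ {G : Graph V} {x y k} → Walk G x y k → SimplePath G x y
  Walk⇒SimplePath here = [] , [] ∷ [] , single , last-one
  Walk⇒SimplePath {x = x} (step {y = x′} p w) with Walk⇒SimplePath w
  ... | vs , u , P , L with x ∈? (x′ ∷ vs)
  ...   | yes x∈ = SimplePath-suffix x∈ u P L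
  ...   | no x∉  = x′ ∷ vs , ¬Any⇒All¬ _ x∉ ∷ u , cons p P , last-cons L

  -- In an acyclic graph a simple path from x to y followed by an edge y x must be that edge alone.
  module _ {G : Graph V} (acyclic : ¬ HasCycle G) where

    Adj-decidable : Connected G → Decidable (Adj G)
    Adj-decidable connected x y with Walk⇒SimplePath (proj₂ (connected x y))
    ... | [] , _ , _ , last-one                           = no (irrefl G)
    ... | _ ∷ [] , _ , cons p single , last-cons last-one = yes p
    ... | w₁ ∷ w₂ ∷ ws , u , P , L                        =
      no λ p → acyclic (_ , w₁ , w₂ , ws , _ , u , P , L , sym G p)

    edge-isBridge : ∀ {u v} → Adj G u v → ¬ Reachable (removeEdge G u v) u v
    edge-isBridge p (_ , w) with Walk⇒SimplePath w
    ... | [] , _ , _ , last-one                                    = irrefl G p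
    ... | _ ∷ [] , _ , cons (_ , p≠uv) single , last-cons last-one = p≠uv (inj₁ (refl , refl))
    ... | w₁ ∷ w₂ ∷ ws , u , P , L                                 =
      acyclic (_ , w₁ , w₂ , ws , _ , u , Path-forget P , L , sym G p)

module _ {V : Set} (_≟_ : DecidableEquality V) {G : Graph V} {u v : V} where

  reaches-endpoint-avoiding : ∀ {a k} → Walk G a u k →
                              Reachable (removeEdge G u v) a u ⊎ Reachable (removeEdge G u v) a v
  reaches-endpoint-avoiding here = inj₁ (_ , here)
  reaches-endpoint-avoiding {a} (step {y = a′} p w) with SameEdge? _≟_ a a′ u v
  ... | yes (inj₁ (refl , _)) = inj₁ (_ , here)
  ... | yes (inj₂ (refl , _)) = inj₂ (_ , here)
  ... | no p≠uv               = Sum.map extend extend (reaches-endpoint-avoiding w)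
    where
    extend : ∀ {z} → Reachable (removeEdge G u v) a′ z → Reachable (removeEdge G u v) a z
    extend (_ , w′) = _ , step (p , p≠uv) w′

  bridge-separates : ¬ Reachable (removeEdge G u v) u v →
                     ∀ {a} → Reachable G a u → ∃[ y ] ¬ Reachable (removeEdge G u v) a y
  bridge-separates bridge (_ , w) with reaches-endpoint-avoiding w
  ... | inj₁ a~u = v , λ a~v → bridge (Reachable-trans (Reachable-sym a~u) a~v)
  ... | inj₂ a~v = u , λ a~u → bridge (Reachable-trans (Reachable-sym a~u) a~v)

×-searchable : Searchable V → Searchable W → Searchable (V × W)
×-searchable search₁ search₂ P? =
  map′ (λ (a , b , p) → (a , b) , p) (λ ((a , b) , p) → a , b , p)
       (search₁ λ a → search₂ λ b → P? (a , b))

□-adjacent? : {G : Graph V} {H : Graph W} → DecidableEquality V → DecidableEquality W →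
              Decidable (Adj G) → Decidable (Adj H) → Decidable (Adj (G □ H))
□-adjacent? _≟₁_ _≟₂_ adj₁? adj₂? (a , b) (c , d) =
  (adj₁? a c ×-dec b ≟₂ d) ⊎-dec (a ≟₁ c ×-dec adj₂? b d)

□-swap : {G : Graph V} {H : Graph W} → Homomorphism (G □ H) (H □ G) swap
□-swap {x = _ , _} {y = _ , _} (inj₁ (p , refl)) = inj₂ (refl , p)
□-swap {x = _ , _} {y = _ , _} (inj₂ (refl , q)) = inj₁ (q , refl)

□-swap-removeEdge : {G : Graph V} {H : Graph W} {u v : V × W} →
                    Homomorphism (removeEdge (G □ H) u v) (removeEdge (H □ G) (swap u) (swap v)) swap
□-swap-removeEdge {G = G} {H} = removeEdge-hom {G = G □ H} {H = H □ G} swap (cong swap) (□-swap {G = G} {H})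

Monitors-swap : {G : Graph V} {H : Graph W} {x u v : V × W} →
                Monitors (H □ G) (swap x) (swap u) (swap v) → Monitors (G □ H) x u v
Monitors-swap {G = G} {H} (y , d₁ , d₂ , D₁ , D₂ , d₁≢d₂) =
  swap y , d₁ , d₂
  , Dist-transfer (Walk-map swap (□-swap {G = H} {G})) (Walk-map swap (□-swap {G = G} {H})) D₁
  , Dist-transfer (Walk-map swap (□-swap-removeEdge {G = H} {G}))
                  (Walk-map swap (□-swap-removeEdge {G = G} {H})) D₂
  , d₁≢d₂

Walk-split : {G : Graph V} {H : Graph W} {a c : V} {b d : W} {k : ℕ} → Walk (G □ H) (a , b) (c , d) k →
             ∃₂ λ k₁ k₂ → Walk G a c k₁ × Walk H b d k₂ × k₁ + k₂ ≡ k
Walk-split here = 0 , 0 , here , here , refl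
Walk-split (step {y = _ , _} (inj₁ (p , refl)) w) with Walk-split w
... | k₁ , k₂ , w₁ , w₂ , refl = suc k₁ , k₂ , step p w₁ , w₂ , refl
Walk-split (step {y = _ , _} (inj₂ (refl , q)) w) with Walk-split w
... | k₁ , k₂ , w₁ , w₂ , refl = k₁ , suc k₂ , w₁ , step q w₂ , +-suc k₁ k₂

module RowEdge {V W : Set} {G : Graph V} {H : Graph W} {u v : V} {b : W} where

  G□H−e : Graph (V × W)
  G□H−e = removeEdge (G □ H) (u , b) (v , b)

  row : ∀ b′ → Homomorphism G (G □ H) (_, b′)
  row b′ p = inj₁ (p , refl)

  row-avoids : ∀ {b′} → b′ ≢ b → Homomorphism G G□H−e (_, b′)
  row-avoids b′≢b p = inj₁ (p , refl) , λ { (inj₁ (e , _)) → b′≢b (cong proj₂ e)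
                                          ; (inj₂ (e , _)) → b′≢b (cong proj₂ e) }

  column-avoids : ∀ c → Homomorphism H G□H−e (c ,_)
  column-avoids c q = inj₂ (refl , q) , λ { (inj₁ (refl , refl)) → irrefl H q
                                          ; (inj₂ (refl , refl)) → irrefl H q }

  Walk-reroute : ∀ {a b′ z k} → b′ ≢ b → Walk (G □ H) (a , b′) z k → Walk G□H−e (a , b′) z k
  Walk-reroute {z = c , _} b′≢b w with Walk-split w
  ... | _ , _ , w₁ , w₂ , refl = Walk-map _ (row-avoids b′≢b) w₁ ++ᵂ Walk-map _ (column-avoids c) w₂

  off-row-¬Monitors : ∀ {a b′} → b′ ≢ b → ¬ Monitors (G □ H) (a , b′) (u , b) (v , b)
  off-row-¬Monitors b′≢b (_ , _ , _ , D₁ , D₂ , d₁≢d₂) =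
    d₁≢d₂ (Dist-unique (Dist-transfer (Walk-reroute b′≢b) Walk-forget D₁) D₂)

  Walk-leaves-row : ∀ {a c d l} → Walk G□H−e (a , b) (c , d) l →
                    (d ≡ b × Walk (removeEdge G u v) a c l)
                    ⊎ ∃₂ λ k₁ k₂ → Walk G a c k₁ × Walk H b d (suc k₂) × k₁ + suc k₂ ≡ l
  Walk-leaves-row here = inj₁ (refl , here)
  Walk-leaves-row (step {y = _ , _} (inj₁ (p , refl) , p≠e) w) with Walk-leaves-row w
  ... | inj₁ (refl , w′) = inj₁ (refl , step (p , p≠uv) w′)
    where
    p≠uv : ¬ SameEdge _ _ u v
    p≠uv (inj₁ (refl , refl)) = p≠e (inj₁ (refl , refl))
    p≠uv (inj₂ (refl , refl)) = p≠e (inj₂ (refl , refl))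
  ... | inj₂ (k₁ , k₂ , w₁ , w₂ , refl) = inj₂ (suc k₁ , k₂ , step p w₁ , w₂ , refl)
  Walk-leaves-row (step {y = _ , _} (inj₂ (refl , q) , _) w) with Walk-split (Walk-forget w)
  ... | k₁ , k₂ , w₁ , w₂ , refl = inj₂ (k₁ , k₂ , w₁ , step q w₂ , +-suc k₁ k₂)

  Walk-detour : ∀ {a c b′ k} → Adj H b b′ → Walk G a c k → Walk G□H−e (a , b) (c , b) (suc (k + 1))
  Walk-detour {a} {c} q w =
    step (column-avoids a q) (Walk-map _ (row-avoids b′≢b) w ++ᵂ step (column-avoids c (sym H q)) here)
    where
    b′≢b : _ ≢ b
    b′≢b refl = irrefl H q

  G□H−e-Walk-longer : ∀ {a c K l} → ¬ Reachable (removeEdge G u v) a c →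
                      Dist (G □ H) (a , b) (c , b) (just K) → Walk G□H−e (a , b) (c , b) l → K < l
  G□H−e-Walk-longer separated (_ , K-min) w with Walk-leaves-row w
  ... | inj₁ (_ , w′)                  = ⊥-elim (separated (_ , w′))
  ... | inj₂ (k₁ , k₂ , w₁ , _ , refl) = ≤-<-trans (K-min k₁ (Walk-map _ (row b) w₁)) (m<m+n k₁ z<s)

  module _ (_≟₁_ : DecidableEquality V) (_≟₂_ : DecidableEquality W)
           (search₁ : Searchable V) (search₂ : Searchable W)
           (adj₁? : Decidable (Adj G)) (adj₂? : Decidable (Adj H)) where

    open Distance (≡-dec _≟₁_ _≟₂_) (×-searchable search₁ search₂)

    private
      □-adj? : Decidable (Adj (G □ H))
      □-adj? = □-adjacent? {G = G} {H = H} _≟₁_ _≟₂_ adj₁? adj₂?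

    row-edge-Monitors : ∀ {a c b′} → Adj H b b′ → Reachable G a c → ¬ Reachable (removeEdge G u v) a c →
                        Monitors (G □ H) (a , b) (u , b) (v , b)
    row-edge-Monitors {c = c} q (_ , w) separated
      with distance □-adj? (Walk-map _ (row b) w)
         | distance (removeEdge-adjacent? {G = G □ H} (≡-dec _≟₁_ _≟₂_) □-adj?) (Walk-detour q w)
    ... | K , D | K′ , D′ =
      (c , b) , just K , just K′ , D , D′ ,
      λ K≡K′ → <⇒≢ (G□H−e-Walk-longer separated D (proj₁ D′)) (just-injective K≡K′)

module _ {m : ℕ} {T : Graph (Fin m)} (tree : IsTree T) where
  open SimplePaths (_≟ᶠ_ {m})

  tree-adjacent? : Decidable (Adj T)
  tree-adjacent? = Adj-decidable (proj₂ tree) (proj₁ tree)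

  tree-separates : ∀ {u v} → Adj T u v → ∀ a → ∃[ c ] ¬ Reachable (removeEdge T u v) a c
  tree-separates {u} p a = bridge-separates _≟ᶠ_ (edge-isBridge (proj₂ tree) p) (proj₁ tree a u)

tree-row-edge-Monitors : ∀ {m n} {T₁ : Graph (Fin m)} {T₂ : Graph (Fin n)} → IsTree T₁ → IsTree T₂ →
                         (∀ b → ∃[ b′ ] Adj T₂ b b′) →
                         ∀ {u v} → Adj T₁ u v → ∀ a b → Monitors (T₁ □ T₂) (a , b) (u , b) (v , b)
tree-row-edge-Monitors tree₁ tree₂ neighbour p a b with tree-separates tree₁ p a
... | c , separated =
  RowEdge.row-edge-Monitors _≟ᶠ_ _≟ᶠ_ any? any? (tree-adjacent? tree₁) (tree-adjacent? tree₂)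
    (proj₂ (neighbour b)) (proj₁ tree₁ a c) separated

tree-meets-rows-and-columns⇒IsDEMSet :
  ∀ {m n} {T₁ : Graph (Fin m)} {T₂ : Graph (Fin n)} {M : List (Fin m × Fin n)} → IsTree T₁ → IsTree T₂ →
  (∀ a → ∃[ a′ ] Adj T₁ a a′) → (∀ b → ∃[ b′ ] Adj T₂ b b′) →
  (∀ b → ∃[ a ] ((a , b) ∈ M)) → (∀ a → ∃[ b ] ((a , b) ∈ M)) → IsDEMSet (T₁ □ T₂) M
tree-meets-rows-and-columns⇒IsDEMSet tree₁ tree₂ _ neighbour₂ rows _ (_ , b) _ (inj₁ (p , refl))
  with rows b
... | a , ab∈M = (a , b) , ab∈M , tree-row-edge-Monitors tree₁ tree₂ neighbour₂ p a b
tree-meets-rows-and-columns⇒IsDEMSet tree₁ tree₂ neighbour₁ _ _ columns (a , _) _ (inj₂ (refl , q))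
  with columns a
... | b , ab∈M = (a , b) , ab∈M , Monitors-swap (tree-row-edge-Monitors tree₂ tree₁ neighbour₁ q b a)

IsDEMSet-swap : {G : Graph V} {H : Graph W} {M : List (V × W)} →
                IsDEMSet (G □ H) M → IsDEMSet (H □ G) (map swap M)
IsDEMSet-swap {G = G} {H} D p q e with D (swap p) (swap q) (□-swap {G = H} {G} e)
... | x , x∈M , x-monitors = swap x , ∈-map⁺ swap x∈M , Monitors-swap x-monitors

IsDEMSet⇒meets-every-row : {G : Graph V} {H : Graph W} {M : List (V × W)} → DecidableEquality W →
                           Adj G u v → IsDEMSet (G □ H) M → ∀ b → b ∈ map proj₂ M
IsDEMSet⇒meets-every-row {u = u} {v} _≟_ p D b with D (u , b) (v , b) (inj₁ (p , refl))
... | (_ , b′) , x∈M , x-monitors with b′ ≟ b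
...   | yes refl = ∈-map⁺ proj₂ x∈M
...   | no b′≢b  = ⊥-elim (RowEdge.off-row-¬Monitors b′≢b x-monitors)

covering-length : ∀ {n} (xs : List (Fin n)) → (∀ i → i ∈ xs) → n ≤ length xs
covering-length xs covers = ≮⇒≥ λ short → collision (pigeonhole short (λ i → index (covers i)))
  where
  collision : ¬ ∃₂ λ i j → i <ᶠ j × index (covers i) ≡ index (covers j)
  collision (i , j , i<j , same) =
    <-irrefl (cong toℕ (≡.trans (lookup-index (covers i))
                       (≡.trans (cong (lookup xs) same) (≡.sym (lookup-index (covers j)))))) i<j

IsDEMSet⇒length : ∀ {m n} {G : Graph (Fin m)} {H : Graph (Fin n)} {u v u′ v′} {M : List (Fin m × Fin n)} →
                  Adj G u v → Adj H u′ v′ → IsDEMSet (G □ H) M → m ⊔ n ≤ length M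
IsDEMSet⇒length {m} {n} {M = M} p q D = ⊔-lub m≤|M| n≤|M|
  where
  open ≤-Reasoning
  n≤|M| : n ≤ length M
  n≤|M| = begin
    n                      ≤⟨ covering-length _ (IsDEMSet⇒meets-every-row _≟ᶠ_ p D) ⟩
    length (map proj₂ M)   ≡⟨ length-map proj₂ M ⟩
    length M               ∎
  m≤|M| : m ≤ length M
  m≤|M| = begin
    m                                 ≤⟨ covering-length _ (IsDEMSet⇒meets-every-row _≟ᶠ_ q (IsDEMSet-swap D)) ⟩
    length (map proj₂ (map swap M))   ≡⟨ length-map proj₂ (map swap M) ⟩
    length (map swap M)               ≡⟨ length-map swap M ⟩
    length M                          ∎

clamp : ∀ r → ℕ → Fin (suc r)
clamp r i = fromℕ< (s≤s (m⊓n≤n i r))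

toℕ-clamp : ∀ r i → toℕ (clamp r i) ≡ i ⊓ r
toℕ-clamp r i = toℕ-fromℕ< (s≤s (m⊓n≤n i r))

clamp-toℕ : ∀ r (j : Fin (suc r)) → clamp r (toℕ j) ≡ j
clamp-toℕ r j = toℕ-injective (≡.trans (toℕ-clamp r (toℕ j)) (m≤n⇒m⊓n≡m (≤-pred (toℕ<n j))))

module Diagonal (p q : ℕ) where

  point : Fin (suc (p ⊔ q)) → Fin (suc p) × Fin (suc q)
  point i = clamp p (toℕ i) , clamp q (toℕ i)

  point-injective : ∀ {i j} → point i ≡ point j → i ≡ j
  point-injective {i} {j} eq = toℕ-injective (begin
    toℕ i                   ≡⟨ max-of-clamps i ⟨
    toℕ i ⊓ p ⊔ toℕ i ⊓ q   ≡⟨ cong₂ _⊔_ (clamp-cancel p (cong proj₁ eq))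
                                         (clamp-cancel q (cong proj₂ eq)) ⟩
    toℕ j ⊓ p ⊔ toℕ j ⊓ q   ≡⟨ max-of-clamps j ⟩
    toℕ j                   ∎)
    where
    open ≡.≡-Reasoning
    max-of-clamps : ∀ i → toℕ i ⊓ p ⊔ toℕ i ⊓ q ≡ toℕ i
    max-of-clamps i = ≡.trans (≡.sym (⊓-distribˡ-⊔ (toℕ i) p q)) (m≤n⇒m⊓n≡m (≤-pred (toℕ<n i)))
    clamp-cancel : ∀ r {i j} → clamp r i ≡ clamp r j → i ⊓ r ≡ j ⊓ r
    clamp-cancel r {i} {j} e = ≡.trans (≡.sym (toℕ-clamp r i)) (≡.trans (cong toℕ e) (toℕ-clamp r j))

  diagonal : List (Fin (suc p) × Fin (suc q))
  diagonal = map point (allFin (suc (p ⊔ q)))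

  diagonal-unique : Unique diagonal
  diagonal-unique = map⁺ point-injective (allFin⁺ _)

  diagonal-length : length diagonal ≡ suc (p ⊔ q)
  diagonal-length = ≡.trans (length-map point (allFin _)) (length-tabulate id)

  point∈diagonal : ∀ i → point i ∈ diagonal
  point∈diagonal i = ∈-map⁺ point (∈-allFin i)

  clamp-fromℕ< : ∀ r (j : Fin (suc r)) (j<1+p⊔q : toℕ j < suc (p ⊔ q)) →
                 clamp r (toℕ (fromℕ< j<1+p⊔q)) ≡ j
  clamp-fromℕ< r j j<1+p⊔q = ≡.trans (cong (clamp r) (toℕ-fromℕ< j<1+p⊔q)) (clamp-toℕ r j)

  diagonal-meets-row : ∀ b → ∃[ a ] ((a , b) ∈ diagonal)
  diagonal-meets-row b =
    proj₁ (point i) ,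
    subst (_∈ diagonal) (cong (proj₁ (point i) ,_) (clamp-fromℕ< q b b<1+p⊔q)) (point∈diagonal i)
    where
    b<1+p⊔q : toℕ b < suc (p ⊔ q)
    b<1+p⊔q = s≤s (≤-trans (≤-pred (toℕ<n b)) (m≤n⊔m p q))
    i : Fin (suc (p ⊔ q))
    i = fromℕ< b<1+p⊔q

  diagonal-meets-column : ∀ a → ∃[ b ] ((a , b) ∈ diagonal)
  diagonal-meets-column a =
    proj₂ (point i) ,
    subst (_∈ diagonal) (cong (_, proj₂ (point i)) (clamp-fromℕ< p a a<1+p⊔q)) (point∈diagonal i)
    where
    a<1+p⊔q : toℕ a < suc (p ⊔ q)
    a<1+p⊔q = s≤s (≤-trans (≤-pred (toℕ<n a)) (m≤m⊔n p q))
    i : Fin (suc (p ⊔ q))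
    i = fromℕ< a<1+p⊔q

Fin-other : ∀ {k} (x : Fin (suc (suc k))) → ∃[ y ] x ≢ y
Fin-other zero    = suc zero , λ ()
Fin-other (suc _) = zero , λ ()

Connected⇒neighbour : Connected G → ∀ x → ∃[ y ] x ≢ y → ∃[ y′ ] Adj G x y′
Connected⇒neighbour connected x (y , x≢y) with connected x y
... | _ , here     = ⊥-elim (x≢y refl)
... | _ , step p _ = _ , p

mainTheorem12 : (m n : ℕ) → m ≥ 2 → n ≥ 2 →
    (T₁ : Graph (Fin m)) → (T₂ : Graph (Fin n)) → IsTree T₁ → IsTree T₂ →
    DEM (T₁ □ T₂) (m ⊔ n)
mainTheorem12 (suc (suc p)) (suc (suc q)) (s≤s (s≤s _)) (s≤s (s≤s _)) T₁ T₂ tree₁ tree₂ =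
  (diagonal , diagonal-unique , diagonal-IsDEMSet , diagonal-length) ,
  λ _ _ D → IsDEMSet⇒length (proj₂ (neighbour₁ zero)) (proj₂ (neighbour₂ zero)) D
  where
  open Diagonal (suc p) (suc q)
  neighbour₁ : ∀ a → ∃[ a′ ] Adj T₁ a a′
  neighbour₁ a = Connected⇒neighbour (proj₁ tree₁) a (Fin-other a)
  neighbour₂ : ∀ b → ∃[ b′ ] Adj T₂ b b′
  neighbour₂ b = Connected⇒neighbour (proj₁ tree₂) b (Fin-other b)
  diagonal-IsDEMSet : IsDEMSet (T₁ □ T₂) diagonal
  diagonal-IsDEMSet = tree-meets-rows-and-columns⇒IsDEMSet tree₁ tree₂ neighbour₁ neighbour₂
                        diagonal-meets-row diagonal-meets-column
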